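{- Let $\mathbf A$ be a finite symmetric relation algebra with a normal representation such that $\mathbf A$ has all $1$-cycles and admits a Siggers behavior; let $R\subseteq A_0^3$ be the set of allowed triples and $\mathfrak A_0$ the atom structure of $\mathbf A$. Let $a,a',b,c\in A_0$ be such that $(a,b,c)\notin R$, $(a,a,b)\notin R$, and $(a',b,c)\in R$. Then $(a',a)$ is not a semilattice edge of $\mathfrak A_0$.
   Context: $\mathbf A=(A;\cup,\bar{\ },0,1,\mathrm{id},\breve{\ },\circ)$ is a relation algebra (Tarski's axioms), symmetric if $\breve a=a$ for all $a$; $A_0$ is its set of atoms. A triple $(x,y,z)\in A_0^3$ is allowed if $z\le x\circ y$. $\mathbf A$ has all $1$-cycles if $(a,a,a)$ is allowed for all $a$. $\mathbf A$ admits a Siggers behavior if there is $s\colon A_0^6\to A_0$ preserving the allowed triples, with $s(x_1,\dots,x_6)\in\{x_1,\dots,x_6\}$ and $s(x,x,y,y,z,z)=s(y,z,x,z,x,y)$. A normal representation is a representation that is square, homogeneous and fully universal (every atomic closed network is satisfiable in it). The atom structure $\mathfrak A_0$ has domain $A_0$, a unary relation $\{a\in A_0\mid a\le x\}$ for each $x\in A$ (so every subset of $A_0$), the binary relation $\{(a_1,a_2)\mid \breve{a_1}=a_2\}$, and the ternary relation $R$. A polymorphism of $\mathfrak A_0$ is an operation $A_0^n\to A_0$ preserving all its relations componentwise. A pair $(a,b)$ is a semilattice edge of $\mathfrak A_0$ if there is a binary polymorphism $p$ with $p(a,b)=p(b,a)=p(b,b)=b$ and $p(a,a)=a$. -}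

module Defs where

open import Data.Nat using (ℕ)
open import Data.Fin using (Fin; zero; suc)
open import Data.Product using (Σ; ∃; ∃-syntax; _×_; _,_; proj₁; proj₂)
open import Data.Sum using (_⊎_)
open import Data.Empty using (⊥)
open import Relation.Nullary using (¬_)
open import Relation.Binary.PropositionalEquality using (_≡_)
open import Function.Bundles using (_↔_; Inverse)

infix 2 _⟺_
_⟺_ : Set → Set → Set
P ⟺ Q = (P → Q) × (Q → P)

record RelationAlgebra : Set₁ where
  infixl 6 _∪_
  infixl 7 _∘_
  field
    Carrier : Set
    _∪_     : Carrier → Carrier → Carrier
    ‾_      : Carrier → Carrier
    𝟘 𝟙     : Carrier
    idᴿ     : Carrier
    _˘      : Carrier → Carrier
    _∘_     : Carrier → Carrier → Carrier
    ∪-comm    : ∀ x y → x ∪ y ≡ y ∪ x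
    ∪-assoc   : ∀ x y z → x ∪ (y ∪ z) ≡ (x ∪ y) ∪ z
    huntington : ∀ x y → ‾ (‾ x ∪ y) ∪ ‾ (‾ x ∪ ‾ y) ≡ x
    𝟙-def     : ∀ x → x ∪ ‾ x ≡ 𝟙
    𝟘-def     : 𝟘 ≡ ‾ 𝟙
    ∘-assoc   : ∀ x y z → x ∘ (y ∘ z) ≡ (x ∘ y) ∘ z
    ∘-distribʳ : ∀ x y z → (x ∪ y) ∘ z ≡ (x ∘ z) ∪ (y ∘ z)
    ∘-identityʳ : ∀ x → x ∘ idᴿ ≡ x
    ˘-invol   : ∀ x → (x ˘) ˘ ≡ x
    ˘-distrib-∪ : ∀ x y → (x ∪ y) ˘ ≡ (x ˘) ∪ (y ˘)
    ˘-distrib-∘ : ∀ x y → (x ∘ y) ˘ ≡ (y ˘) ∘ (x ˘)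
    tarski    : ∀ x y → ((x ˘) ∘ ‾ (x ∘ y)) ∪ ‾ y ≡ ‾ y

module _ (𝐀 : RelationAlgebra) where
  open RelationAlgebra 𝐀

  _≤ᴬ_ : Carrier → Carrier → Set
  x ≤ᴬ y = x ∪ y ≡ y

  IsFinite : Set
  IsFinite = ∃[ n ] (Fin n ↔ Carrier)

  IsSymmetric : Set
  IsSymmetric = ∀ x → x ˘ ≡ x

  IsAtom : Carrier → Set
  IsAtom a = ¬ (a ≡ 𝟘) × (∀ y → y ≤ᴬ a → (y ≡ 𝟘) ⊎ (y ≡ a))

  Atom : Set
  Atom = Σ Carrier IsAtom

  Allowed : Atom → Atom → Atom → Set
  Allowed x y z = proj₁ z ≤ᴬ (proj₁ x ∘ proj₁ y)

  HasAll1Cycles : Set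
  HasAll1Cycles = ∀ a → Allowed a a a

  SiggersBehaviour : Set
  SiggersBehaviour =
    Σ (Atom → Atom → Atom → Atom → Atom → Atom → Atom) λ s →
      (∀ x₁ x₂ x₃ x₄ x₅ x₆ y₁ y₂ y₃ y₄ y₅ y₆ z₁ z₂ z₃ z₄ z₅ z₆ →
         Allowed x₁ y₁ z₁ → Allowed x₂ y₂ z₂ → Allowed x₃ y₃ z₃ →
         Allowed x₄ y₄ z₄ → Allowed x₅ y₅ z₅ → Allowed x₆ y₆ z₆ →
         Allowed (s x₁ x₂ x₃ x₄ x₅ x₆) (s y₁ y₂ y₃ y₄ y₅ y₆)
                 (s z₁ z₂ z₃ z₄ z₅ z₆))
    × (∀ x₁ x₂ x₃ x₄ x₅ x₆ →
         let r = proj₁ (s x₁ x₂ x₃ x₄ x₅ x₆) in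
         (r ≡ proj₁ x₁) ⊎ (r ≡ proj₁ x₂) ⊎ (r ≡ proj₁ x₃) ⊎
         (r ≡ proj₁ x₄) ⊎ (r ≡ proj₁ x₅) ⊎ (r ≡ proj₁ x₆))
    × (∀ x y z → proj₁ (s x x y y z z) ≡ proj₁ (s y z x z x y))

  record SquareRepresentation (D : Set) : Set₁ where
    field
      h : Carrier → D → D → Set
      h-𝟘  : ∀ u v → ¬ h 𝟘 u v
      h-𝟙  : ∀ u v → h 𝟙 u v
      h-∪  : ∀ x y u v → h (x ∪ y) u v ⟺ (h x u v ⊎ h y u v)
      h-‾  : ∀ x u v → h (‾ x) u v ⟺ ¬ h x u v
      h-id : ∀ u v → h idᴿ u v ⟺ u ≡ v
      h-˘  : ∀ x u v → h (x ˘) u v ⟺ h x v u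
      h-∘  : ∀ x y u v → h (x ∘ y) u v ⟺ (∃[ w ] (h x u w × h y w v))
      h-injective : ∀ x y → (∀ u v → h x u v ⟺ h y u v) → x ≡ y

  module _ {D : Set} (ρ : SquareRepresentation D) where
    open SquareRepresentation ρ

    IsAutomorphism : D ↔ D → Set
    IsAutomorphism σ = ∀ x u v → h x u v ⟺ h x (Inverse.to σ u) (Inverse.to σ v)

    -- every isomorphism between finite substructures (given as tuples
    -- f, g satisfying the same relations) extends to an automorphism
    IsHomogeneous : Set
    IsHomogeneous =
      ∀ (k : ℕ) (f g : Fin k → D) →
        (∀ x i j → h x (f i) (f j) ⟺ h x (g i) (g j)) →
        Σ (D ↔ D) λ σ → IsAutomorphism σ × (∀ i → Inverse.to σ (f i) ≡ g i)

    -- every atomic closed network is satisfiable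
    IsFullyUniversal : Set
    IsFullyUniversal =
      ∀ (n : ℕ) (λ' : Fin n → Fin n → Atom) →
        (∀ i → proj₁ (λ' i i) ≤ᴬ idᴿ) →
        (∀ i j → proj₁ (λ' j i) ≡ proj₁ (λ' i j) ˘) →
        (∀ i j k → Allowed (λ' i j) (λ' j k) (λ' i k)) →
        Σ (Fin n → D) λ e → (∀ i j → h (proj₁ (λ' i j)) (e i) (e j))

  HasNormalRepresentation : Set₁
  HasNormalRepresentation =
    Σ Set λ D → Σ (SquareRepresentation D) λ ρ →
      IsHomogeneous {D} ρ × IsFullyUniversal {D} ρ

  IsPolymorphism : (n : ℕ) → ((Fin n → Atom) → Atom) → Set
  IsPolymorphism n p =
    (∀ x (as : Fin n → Atom) → (∀ i → proj₁ (as i) ≤ᴬ x) → proj₁ (p as) ≤ᴬ x)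
    × (∀ (as bs : Fin n → Atom) → (∀ i → proj₁ (as i) ˘ ≡ proj₁ (bs i)) →
         proj₁ (p as) ˘ ≡ proj₁ (p bs))
    × (∀ (as bs cs : Fin n → Atom) → (∀ i → Allowed (as i) (bs i) (cs i)) →
         Allowed (p as) (p bs) (p cs))

  pair : Atom → Atom → Fin 2 → Atom
  pair a b zero = a
  pair a b (suc zero) = b

  IsSemilatticeEdge : Atom → Atom → Set
  IsSemilatticeEdge a b =
    Σ ((Fin 2 → Atom) → Atom) λ p → IsPolymorphism 2 p ×
      (proj₁ (p (pair a b)) ≡ proj₁ b) × (proj₁ (p (pair b a)) ≡ proj₁ b) ×
      (proj₁ (p (pair b b)) ≡ proj₁ b) × (proj₁ (p (pair a a)) ≡ proj₁ a)

{-# OPTIONS --safe #-}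
-- A binary polymorphism of the atom structure is conservative: the unary
-- relation {x, y} forces p(x, y) ∈ {x, y}.  In a symmetric algebra the allowed
-- triples are invariant under all permutations (Peirce) and the identity is an
-- atom e with (e, x, z) allowed iff z = x.  If p(a', a) = p(a, a') = a, then
-- applying p to suitable pairs of allowed triples determines p(b, a) = a,
-- p(b, e) = e, p(e, b) = b and p(a, b) = b in turn, and finally the pair of
-- allowed triples (e, a, a), (c, a', b) is sent to (p(e, c), a, b), which is
-- (e, a, b) or (c, a, b); neither is allowed.
module Submission where

open import Defs
open import Level using (0ℓ)
open import Data.Fin using (Fin; zero; suc)
open import Data.Fin.Properties using (inj⇒≟)
open import Data.Product using (∃-syntax; _,_; proj₁; proj₂)
open import Data.Sum using (_⊎_; inj₁; inj₂; reduce)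
open import Data.Empty using (⊥; ⊥-elim)
open import Function.Base using (_on_)
open import Function.Properties.Inverse using (↔-sym; ↔⇒↣)
open import Relation.Nullary using (¬_; yes; no)
open import Relation.Nullary.Decidable using (Dec; decidable-stable)
open import Relation.Binary.Core using (Rel)
open import Relation.Binary.Definitions using (DecidableEquality)
open import Relation.Binary.Structures using (IsEquivalence)
open import Relation.Binary.Construct.On as On using ()
open import Relation.Binary.PropositionalEquality as ≡
  using (_≡_; refl; sym; subst; subst₂; cong₂; module ≡-Reasoning)

module ConservativeOperations
  {X : Set} {_≈_ : Rel X 0ℓ} (≈-isEquivalence : IsEquivalence _≈_)
  (R : X → X → X → Set)
  (R-resp : ∀ {x y z x' y' z'} → x ≈ x' → y ≈ y' → z ≈ z' → R x y z → R x' y' z')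
  (R-swap₁₂ : ∀ {x y z} → R x y z → R y x z)
  (R-swap₁₃ : ∀ {x y z} → R x y z → R z y x)
  (R-refl : ∀ x → R x x x)
  (e : X) (R-unitˡ : ∀ x → R e x x) (R-unitˡ⁻¹ : ∀ {x z} → R e x z → z ≈ x)
  where

  open IsEquivalence ≈-isEquivalence renaming (refl to ≈-refl; sym to ≈-sym)

  Conservative : (X → X → X) → Set
  Conservative q = ∀ x y → q x y ≈ x ⊎ q x y ≈ y

  Preserves-R : (X → X → X) → Set
  Preserves-R q = ∀ {x₁ x₂ x₃ y₁ y₂ y₃} →
    R x₁ x₂ x₃ → R y₁ y₂ y₃ → R (q x₁ y₁) (q x₂ y₂) (q x₃ y₃)

  R-unitʳ : ∀ x → R x e x
  R-unitʳ x = R-swap₁₂ (R-unitˡ x)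

  R-unitʳ⁻¹ : ∀ {x z} → R x e z → z ≈ x
  R-unitʳ⁻¹ r = R-unitˡ⁻¹ (R-swap₁₂ r)

  R-inverse : ∀ x → R x x e
  R-inverse x = R-swap₁₃ (R-unitˡ x)

  module _ {q : X → X → X} (q-conservative : Conservative q) (q-preserves : Preserves-R q)
           {a a' b c : X} (¬Rabc : ¬ R a b c) (¬Raab : ¬ R a a b) (Ra'bc : R a' b c)
           (qa'a≈a : q a' a ≈ a) (qaa'≈a : q a a' ≈ a) where

    a≉b : ¬ a ≈ b
    a≉b a≈b = ¬Raab (R-resp ≈-refl ≈-refl a≈b (R-refl a))

    ¬Rbca : ¬ R b c a
    ¬Rbca r = ¬Rabc (R-swap₁₃ (R-swap₁₂ r))

    ¬Rcab : ¬ R c a b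
    ¬Rcab r = ¬Rabc (R-swap₁₂ (R-swap₁₃ r))

    ¬Rbaa : ¬ R b a a
    ¬Rbaa r = ¬Raab (R-swap₁₃ r)

    qba≈a : q b a ≈ a
    qba≈a with q-preserves (R-swap₁₂ (R-swap₁₃ Ra'bc)) (R-refl a)
                 | q-conservative b a | q-conservative c a
    ... | _ | inj₂ qba≈a | _ = qba≈a
    ... | r | inj₁ qba≈b | inj₁ qca≈c = ⊥-elim (¬Rbca (R-resp qba≈b qca≈c qa'a≈a r))
    ... | r | inj₁ qba≈b | inj₂ qca≈a = ⊥-elim (¬Rbaa (R-resp qba≈b qca≈a qa'a≈a r))

    qbe≈e : q b e ≈ e
    qbe≈e with q-preserves (R-unitʳ b) (R-unitˡ a) | q-conservative b e | q-conservative e a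
    ... | _ | inj₂ qbe≈e | _ = qbe≈e
    ... | r | inj₁ qbe≈b | inj₁ qea≈e = ⊥-elim (a≉b (R-unitʳ⁻¹ (R-resp qbe≈b qea≈e qba≈a r)))
    ... | r | inj₁ qbe≈b | inj₂ qea≈a = ⊥-elim (¬Rbaa (R-resp qbe≈b qea≈a qba≈a r))

    qeb≈b : q e b ≈ b
    qeb≈b = ≈-sym (R-unitˡ⁻¹ (R-resp qbe≈e ≈-refl (reduce (q-conservative b b))
                                      (q-preserves (R-unitʳ b) (R-unitˡ b))))

    qab≈b : q a b ≈ b
    qab≈b with q-preserves (R-inverse a) (R-refl b) | q-conservative a b
    ... | _ | inj₂ qab≈b = qab≈b
    ... | r | inj₁ qab≈a = ⊥-elim (¬Raab (R-resp qab≈a qab≈a qeb≈b r))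

    q-absurd : ⊥
    q-absurd with q-preserves (R-unitˡ a) (R-swap₁₃ (R-swap₁₂ Ra'bc)) | q-conservative e c
    ... | r | inj₁ qec≈e = a≉b (≈-sym (R-unitˡ⁻¹ (R-resp qec≈e qaa'≈a qab≈b r)))
    ... | r | inj₂ qec≈c = ¬Rcab (R-resp qec≈c qaa'≈a qab≈b r)

  no-conservative-semilattice-pair :
    ∀ {a a' b c} → ¬ R a b c → ¬ R a a b → R a' b c →
    ∀ q → Conservative q → Preserves-R q → q a' a ≈ a → q a a' ≈ a → ⊥
  no-conservative-semilattice-pair ¬Rabc ¬Raab Ra'bc q q-conservative q-preserves qa'a≈a qaa'≈a =
    q-absurd q-conservative q-preserves ¬Rabc ¬Raab Ra'bc qa'a≈a qaa'≈a

module InRepresentation (𝐀 : RelationAlgebra) {D : Set} (ρ : SquareRepresentation 𝐀 D) where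
  open RelationAlgebra 𝐀
  open SquareRepresentation ρ

  infix 4 _≤_
  _≤_ : Carrier → Carrier → Set
  _≤_ = _≤ᴬ_ 𝐀

  infixl 7 _∩_
  _∩_ : Carrier → Carrier → Carrier
  x ∩ y = ‾ (‾ x ∪ ‾ y)

  h-dec : ∀ x u v → Dec (h x u v)
  h-dec x u v with proj₁ (h-∪ x (‾ x) u v) (subst (λ t → h t u v) (sym (𝟙-def x)) (h-𝟙 u v))
  ... | inj₁ hx = yes hx
  ... | inj₂ h‾x = no (proj₁ (h-‾ x u v) h‾x)

  ≤-intro : ∀ {x y} → (∀ {u v} → h x u v → h y u v) → x ≤ y
  ≤-intro {x} {y} x⊆y = h-injective (x ∪ y) y λ u v →
    (λ hx∪y → reduce′ (proj₁ (h-∪ x y u v) hx∪y)) , (λ hy → proj₂ (h-∪ x y u v) (inj₂ hy))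
    where
    reduce′ : ∀ {u v} → h x u v ⊎ h y u v → h y u v
    reduce′ (inj₁ hx) = x⊆y hx
    reduce′ (inj₂ hy) = hy

  x≤x∪y : ∀ x y → x ≤ x ∪ y
  x≤x∪y x y = ≤-intro λ hx → proj₂ (h-∪ x y _ _) (inj₁ hx)

  y≤x∪y : ∀ x y → y ≤ x ∪ y
  y≤x∪y x y = ≤-intro λ hy → proj₂ (h-∪ x y _ _) (inj₂ hy)

  h-mono : ∀ {x y u v} → x ≤ y → h x u v → h y u v
  h-mono {x} {y} {u} {v} x∪y≡y hx = subst (λ t → h t u v) x∪y≡y (proj₂ (h-∪ x y u v) (inj₁ hx))

  ≡𝟘-intro : ∀ {x} → (∀ {u v} → ¬ h x u v) → x ≡ 𝟘
  ≡𝟘-intro {x} empty =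
    h-injective x 𝟘 λ u v → (λ hx → ⊥-elim (empty hx)) , (λ h𝟘 → ⊥-elim (h-𝟘 u v h𝟘))

  ∩-elimˡ : ∀ {x y u v} → h (x ∩ y) u v → h x u v
  ∩-elimˡ {x} {y} {u} {v} hx∩y = decidable-stable (h-dec x u v) λ ¬hx →
    proj₁ (h-‾ _ u v) hx∩y (proj₂ (h-∪ (‾ x) (‾ y) u v) (inj₁ (proj₂ (h-‾ x u v) ¬hx)))

  ∩-elimʳ : ∀ {x y u v} → h (x ∩ y) u v → h y u v
  ∩-elimʳ {x} {y} {u} {v} hx∩y = decidable-stable (h-dec y u v) λ ¬hy →
    proj₁ (h-‾ _ u v) hx∩y (proj₂ (h-∪ (‾ x) (‾ y) u v) (inj₂ (proj₂ (h-‾ y u v) ¬hy)))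

  ∩-intro : ∀ {x y u v} → h x u v → h y u v → h (x ∩ y) u v
  ∩-intro {x} {y} {u} {v} hx hy =
    proj₂ (h-‾ _ u v) λ h‾x∪‾y → refute (proj₁ (h-∪ (‾ x) (‾ y) u v) h‾x∪‾y)
    where
    refute : h (‾ x) u v ⊎ h (‾ y) u v → ⊥
    refute (inj₁ h‾x) = proj₁ (h-‾ x u v) h‾x hx
    refute (inj₂ h‾y) = proj₁ (h-‾ y u v) h‾y hy

  atom-≤-or-disjoint : ∀ {z} → IsAtom 𝐀 z → ∀ t → z ≤ t ⊎ (∀ {u v} → h z u v → ¬ h t u v)
  atom-≤-or-disjoint {z} (_ , minimal) t with minimal (z ∩ t) (≤-intro ∩-elimˡ)
  ... | inj₁ z∩t≡𝟘 = inj₂ λ hz ht → h-𝟘 _ _ (subst (λ s → h s _ _) z∩t≡𝟘 (∩-intro hz ht))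
  ... | inj₂ z∩t≡z = inj₁ (≤-intro λ hz → ∩-elimʳ {z} (subst (λ s → h s _ _) (sym z∩t≡z) hz))

  atom-≤-atom : ∀ {z x} → IsAtom 𝐀 z → IsAtom 𝐀 x → z ≤ x → z ≡ x
  atom-≤-atom (z≢𝟘 , _) (_ , minimal) z≤x with minimal _ z≤x
  ... | inj₁ z≡𝟘 = ⊥-elim (z≢𝟘 z≡𝟘)
  ... | inj₂ z≡x = z≡x

  atom-≤-∪ : ∀ {z x y} → IsAtom 𝐀 z → IsAtom 𝐀 x → IsAtom 𝐀 y → z ≤ x ∪ y → z ≡ x ⊎ z ≡ y
  atom-≤-∪ {z} {x} {y} z-atom x-atom y-atom z≤x∪y
    with atom-≤-or-disjoint z-atom x | atom-≤-or-disjoint z-atom y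
  ... | inj₁ z≤x | _ = inj₁ (atom-≤-atom z-atom x-atom z≤x)
  ... | inj₂ _ | inj₁ z≤y = inj₂ (atom-≤-atom z-atom y-atom z≤y)
  ... | inj₂ z∦x | inj₂ z∦y =
    ⊥-elim (proj₁ z-atom (≡𝟘-intro λ hz → refute hz (proj₁ (h-∪ x y _ _) (h-mono z≤x∪y hz))))
    where
    refute : ∀ {u v} → h z u v → h x u v ⊎ h y u v → ⊥
    refute hz (inj₁ hx) = z∦x hz hx
    refute hz (inj₂ hy) = z∦y hz hy

∘-comm : (𝐀 : RelationAlgebra) → IsSymmetric 𝐀 →
         let open RelationAlgebra 𝐀 in ∀ x y → x ∘ y ≡ y ∘ x
∘-comm 𝐀 symm x y = begin
  x ∘ y            ≡⟨ sym (symm (x ∘ y)) ⟩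
  (x ∘ y) ˘        ≡⟨ ˘-distrib-∘ x y ⟩
  (y ˘) ∘ (x ˘)    ≡⟨ cong₂ _∘_ (symm y) (symm x) ⟩
  y ∘ x            ∎
  where open RelationAlgebra 𝐀
        open ≡-Reasoning

module InSymmetricRepresentation (𝐀 : RelationAlgebra) (symm : IsSymmetric 𝐀)
                                 {D : Set} (ρ : SquareRepresentation 𝐀 D) where
  open RelationAlgebra 𝐀
  open SquareRepresentation ρ
  open InRepresentation 𝐀 ρ

  h-sym : ∀ x {u v} → h x u v → h x v u
  h-sym x {u} {v} hx = subst (λ t → h t v u) (symm x) (proj₂ (h-˘ x v u) hx)

  atom-peirce : ∀ {x y z} → IsAtom 𝐀 x → IsAtom 𝐀 z → z ≤ x ∘ y → x ≤ z ∘ y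
  atom-peirce {x} {y} {z} x-atom z-atom z≤x∘y with atom-≤-or-disjoint x-atom (z ∘ y)
  ... | inj₁ x≤z∘y = x≤z∘y
  ... | inj₂ x∦z∘y = ⊥-elim (proj₁ z-atom (≡𝟘-intro refute))
    where
    refute : ∀ {u v} → ¬ h z u v
    refute {u} {v} hz with proj₁ (h-∘ x y u v) (h-mono z≤x∘y hz)
    ... | w , hx , hy = x∦z∘y hx (proj₂ (h-∘ z y u w) (v , hz , h-sym y hy))

  idᴿ-isAtom : DecidableEquality Carrier → Atom 𝐀 → IsAtom 𝐀 idᴿ
  idᴿ-isAtom _≟_ (a₀ , a₀≢𝟘 , _) = idᴿ≢𝟘 , minimal
    where
    idᴿ≢𝟘 : ¬ idᴿ ≡ 𝟘
    idᴿ≢𝟘 idᴿ≡𝟘 = a₀≢𝟘 (≡𝟘-intro λ {u} _ →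
      h-𝟘 u u (subst (λ t → h t u u) idᴿ≡𝟘 (proj₂ (h-id u u) refl)))

    minimal : ∀ y → y ≤ idᴿ → y ≡ 𝟘 ⊎ y ≡ idᴿ
    minimal y y≤idᴿ with y ≟ 𝟘
    ... | yes y≡𝟘 = inj₁ y≡𝟘
    ... | no y≢𝟘 = inj₂ (h-injective y idᴿ λ u v →
            h-mono y≤idᴿ , λ hid → subst (h y u) (proj₁ (h-id u v) hid) (loop u))
      where
      -- y ∘ 𝟙 is symmetric, so an edge of y anywhere yields an edge of y
      -- leaving every u, and y ≤ idᴿ makes that edge a loop.
      y-edge-from : ∀ u {s t} → h y s t → ∃[ w ] h y u w
      y-edge-from u {s} {t} hyst
        with proj₁ (h-∘ y 𝟙 u s) (h-sym (y ∘ 𝟙) (proj₂ (h-∘ y 𝟙 s u) (t , hyst , h-𝟙 t u)))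
      ... | w , hyuw , _ = w , hyuw

      y-loop : ∀ {u w} → h y u w → h y u u
      y-loop {u} hyuw = subst (h y u) (sym (proj₁ (h-id u _) (h-mono y≤idᴿ hyuw))) hyuw

      loop : ∀ u → h y u u
      loop u = decidable-stable (h-dec y u u) λ ¬hyuu →
        y≢𝟘 (≡𝟘-intro λ hyst → ¬hyuu (y-loop (proj₂ (y-edge-from u hyst))))

module AtomStructure (𝐀 : RelationAlgebra) (fin : IsFinite 𝐀) (symm : IsSymmetric 𝐀)
                    {D : Set} (ρ : SquareRepresentation 𝐀 D) where
  open RelationAlgebra 𝐀
  open InRepresentation 𝐀 ρ
  open InSymmetricRepresentation 𝐀 symm ρ

  _≈_ : Rel (Atom 𝐀) 0ℓ
  _≈_ = _≡_ on proj₁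

  ≈-isEquivalence : IsEquivalence _≈_
  ≈-isEquivalence = On.isEquivalence proj₁ ≡.isEquivalence

  Allowed-resp : ∀ x y z x' y' z' → x ≈ x' → y ≈ y' → z ≈ z' →
                 Allowed 𝐀 x y z → Allowed 𝐀 x' y' z'
  Allowed-resp _ _ z x' y' _ x≈x' y≈y' z≈z' r =
    subst (_≤ proj₁ x' ∘ proj₁ y') z≈z' (subst₂ (λ s t → proj₁ z ≤ s ∘ t) x≈x' y≈y' r)

  Allowed-swap₁₂ : ∀ x y z → Allowed 𝐀 x y z → Allowed 𝐀 y x z
  Allowed-swap₁₂ x y z r = subst (proj₁ z ≤_) (∘-comm 𝐀 symm (proj₁ x) (proj₁ y)) r

  Allowed-swap₁₃ : ∀ x y z → Allowed 𝐀 x y z → Allowed 𝐀 z y x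
  Allowed-swap₁₃ x _ z r = atom-peirce (proj₂ x) (proj₂ z) r

  idAtom : Atom 𝐀 → Atom 𝐀
  idAtom a₀ = idᴿ , idᴿ-isAtom (inj⇒≟ (↔⇒↣ (↔-sym (proj₂ fin)))) a₀

  idᴿ-∘ : ∀ x → idᴿ ∘ x ≡ x
  idᴿ-∘ x = ≡.trans (∘-comm 𝐀 symm idᴿ x) (∘-identityʳ x)

  Allowed-idˡ : ∀ a₀ x → Allowed 𝐀 (idAtom a₀) x x
  Allowed-idˡ _ x = subst (proj₁ x ≤_) (sym (idᴿ-∘ (proj₁ x))) (≤-intro λ hx → hx)

  Allowed-idˡ⁻¹ : ∀ a₀ x z → Allowed 𝐀 (idAtom a₀) x z → z ≈ x
  Allowed-idˡ⁻¹ _ x z r =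
    atom-≤-atom (proj₂ z) (proj₂ x) (subst (proj₁ z ≤_) (idᴿ-∘ (proj₁ x)) r)

  binary : ((Fin 2 → Atom 𝐀) → Atom 𝐀) → Atom 𝐀 → Atom 𝐀 → Atom 𝐀
  binary p x y = p (pair 𝐀 x y)

  module _ (p : (Fin 2 → Atom 𝐀) → Atom 𝐀) (p-polymorphism : IsPolymorphism 𝐀 2 p) where

    polymorphism₂-conservative : ∀ x y → binary p x y ≈ x ⊎ binary p x y ≈ y
    polymorphism₂-conservative x y = atom-≤-∪ (proj₂ (binary p x y)) (proj₂ x) (proj₂ y)
      (proj₁ p-polymorphism (proj₁ x ∪ proj₁ y) (pair 𝐀 x y) λ
        { zero → x≤x∪y (proj₁ x) (proj₁ y) ; (suc zero) → y≤x∪y (proj₁ x) (proj₁ y) })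

    polymorphism₂-preserves-Allowed : ∀ x₁ x₂ x₃ y₁ y₂ y₃ →
      Allowed 𝐀 x₁ x₂ x₃ → Allowed 𝐀 y₁ y₂ y₃ →
      Allowed 𝐀 (binary p x₁ y₁) (binary p x₂ y₂) (binary p x₃ y₃)
    polymorphism₂-preserves-Allowed x₁ x₂ x₃ y₁ y₂ y₃ rx ry =
      proj₂ (proj₂ p-polymorphism) (pair 𝐀 x₁ y₁) (pair 𝐀 x₂ y₂) (pair 𝐀 x₃ y₃) λ
        { zero → rx ; (suc zero) → ry }

lemmaB4 : (𝐀 : RelationAlgebra) → IsFinite 𝐀 → IsSymmetric 𝐀 →
    HasNormalRepresentation 𝐀 → HasAll1Cycles 𝐀 → SiggersBehaviour 𝐀 →
    (a a' b c : Atom 𝐀) →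
    ¬ Allowed 𝐀 a b c → ¬ Allowed 𝐀 a a b → Allowed 𝐀 a' b c →
    ¬ IsSemilatticeEdge 𝐀 a' a
lemmaB4 𝐀 fin symm (_ , ρ , _) all-1-cycles _ a a' b c ¬Rabc ¬Raab Ra'bc
        (p , p-polymorphism , pa'a≈a , paa'≈a , _) =
  no-conservative-semilattice-pair {a} {a'} {b} {c} ¬Rabc ¬Raab Ra'bc (binary p)
    (polymorphism₂-conservative p p-polymorphism)
    (λ {x₁ x₂ x₃ y₁ y₂ y₃} → polymorphism₂-preserves-Allowed p p-polymorphism x₁ x₂ x₃ y₁ y₂ y₃)
    pa'a≈a paa'≈a
  where
  open AtomStructure 𝐀 fin symm ρ
  open ConservativeOperations ≈-isEquivalence (Allowed 𝐀)
         (λ {x y z x' y' z'} → Allowed-resp x y z x' y' z')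
         (λ {x y z} → Allowed-swap₁₂ x y z) (λ {x y z} → Allowed-swap₁₃ x y z)
         all-1-cycles (idAtom a) (Allowed-idˡ a) (λ {x z} → Allowed-idˡ⁻¹ a x z)
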